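{- Let $n\ge 1$, $k_1,k_2,\ell_2\ge 0$ and $\ell_1\ge -1$ be integers with $k_1+k_2=\ell_1+\ell_2=d$ and $k_2<\ell_2$, and suppose the pairs $(n+d+2,k_1)$, $(n+k_2+1,k_2)$, $(n+d+2,\ell_1)$, $(n+\ell_2+1,\ell_2)$ are valid. Then, regarding both sides as polynomials in $q$, $$u(f^*(\cdot,q),n+d+2,q,k_1,k_2)>u(f^*(\cdot,q),n+d+2,q,\ell_1,\ell_2)$$ for all sufficiently large $q$, and the leading term of the difference of the two sides is $q^{2k_1+k_2}$.
   Context: A pair of integers $(m,k)$ is valid if $-1\le k\le\frac{m-1}{2}$. For $m\ge1$, a function $\phi$ on $\{ -1,\dots,m-1\}$ with $\phi(-1)=0$, and valid $(m,k)$, set $u(\phi,m,q,k)=q^{2k+2}\phi(m-k-1)+\phi(k)+\sum_{i=0}^{k}q^i\sum_{j=k}^{m-2}q^j$, and (two steps) $u(\phi,m,q,k_1,k_2)=q^{2k_1+2}u(\phi,m-k_1-1,q,k_2)+\phi(k_1)+\sum_{i=0}^{k_1}q^i\sum_{j=k_1}^{m-2}q^j$. For a positive integer $m$ let $k^*(m)=m-2^{\lfloor\log_2 m\rfloor}$. Define polynomials $f^*(m,q)\in\mathbb{Z}[q]$ by $f^*(-1,q)=f^*(0,q)=f^*(1,q)=0$, $f^*(2,q)=1$, $f^*(3,q)=q^2+1$, $f^*(4,q)=q^4+2q^2+q+1$, and $f^*(m,q)=u(f^*(\cdot,q),m,q,k^*(m))$ for $m\ge5$. -}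

module Defs where

open import Data.Nat as ℕ using (ℕ; zero; suc)
open import Data.Nat.Logarithm using (⌊log₂_⌋)
open import Data.Integer as ℤ using (ℤ; +_; -[1+_]; ∣_∣)
open import Data.Rational as ℚ using (ℚ)
open import Data.List using (List; []; _∷_; map; replicate; _++_)
open import Data.Product using (_×_; ∃)
open import Relation.Binary.PropositionalEquality using (_≡_)

-- Polynomials in q with integer coefficients: coefficient lists,
-- constant coefficient first (not necessarily normalised).
Poly : Set
Poly = List ℤ

infixl 6 _⊕_
infixl 7 _⊗_

_⊕_ : Poly → Poly → Poly
[] ⊕ q = q
(a ∷ p) ⊕ [] = a ∷ p
(a ∷ p) ⊕ (b ∷ q) = (a ℤ.+ b) ∷ (p ⊕ q)

neg : Poly → Poly
neg = map (λ a → ℤ.- a)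

_⊗_ : Poly → Poly → Poly
[] ⊗ q = []
(a ∷ p) ⊗ q = map (a ℤ.*_) q ⊕ (+ 0 ∷ (p ⊗ q))

X^ : ℕ → Poly
X^ e = replicate e (+ 0) ++ (+ 1 ∷ [])

coeff : Poly → ℕ → ℤ
coeff [] j = + 0
coeff (a ∷ p) zero = a
coeff (a ∷ p) (suc j) = coeff p j

eval : Poly → ℚ → ℚ
eval [] x = ℚ.0ℚ
eval (a ∷ p) x = (a ℚ./ 1) ℚ.+ x ℚ.* eval p x

LeadingTerm : Poly → ℕ → Set
LeadingTerm p e = (coeff p e ≡ + 1) × (∀ j → e ℕ.< j → coeff p j ≡ + 0)

EventuallyGreater : Poly → Poly → Set
EventuallyGreater p r = ∃ λ (Q : ℚ) → ∀ (x : ℚ) → Q ℚ.≤ x → eval r x ℚ.< eval p x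

-- (m,k) valid iff -1 ≤ k ≤ (m-1)/2, i.e. -1 ≤ k and 2k ≤ m - 1
Valid : ℤ → ℤ → Set
Valid m k = (ℤ.- + 1 ℤ.≤ k) × (+ 2 ℤ.* k ℤ.≤ m ℤ.- + 1)

geomFrom : ℕ → ℕ → Poly
geomFrom a zero = []
geomFrom a (suc len) = X^ a ⊕ geomFrom (suc a) len

-- ∑_{j=a}^{b} q^j  (empty if b < a), for a ≥ 0
rangeSum : ℕ → ℤ → Poly
rangeSum a b with b ℤ.- + a ℤ.+ + 1
... | + len = geomFrom a len
... | -[1+ _ ] = []

S : ℤ → ℤ → Poly
S (+ k) m = rangeSum 0 (+ k) ⊗ rangeSum k (m ℤ.- + 2)
S -[1+ _ ] m = []

-- u(φ,m,q,k) = q^(2k+2) φ(m-k-1) + φ(k) + ∑_{i=0}^{k} q^i ∑_{j=k}^{m-2} q^j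
-- (2k+2 ≥ 0 for valid k, so the exponent is taken as ∣2k+2∣)
u : (ℤ → Poly) → ℤ → ℤ → Poly
u φ m k = X^ ∣ + 2 ℤ.* k ℤ.+ + 2 ∣ ⊗ φ (m ℤ.- k ℤ.- + 1) ⊕ φ k ⊕ S k m

u₂ : (ℤ → Poly) → ℤ → ℤ → ℤ → Poly
u₂ φ m k₁ k₂ = X^ ∣ + 2 ℤ.* k₁ ℤ.+ + 2 ∣ ⊗ u φ (m ℤ.- k₁ ℤ.- + 1) k₂ ⊕ φ k₁ ⊕ S k₁ m

kstar : ℕ → ℕ
kstar m = m ℕ.∸ 2 ℕ.^ ⌊log₂ m ⌋

-- extend a function on ℕ to ℤ by 0 on negative arguments (only φ(-1)=0 is used)
ext : (ℕ → Poly) → ℤ → Poly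
ext φ (+ j) = φ j
ext φ -[1+ _ ] = []

-- f*(m,q) computed with fuel; fuel m+1 suffices since every recursive
-- call is at a strictly smaller argument (m-k*-1 < m and k* < m).
fstarFuel : ℕ → ℕ → Poly
fstarFuel zero m = []
fstarFuel (suc f) 0 = []
fstarFuel (suc f) 1 = []
fstarFuel (suc f) 2 = + 1 ∷ []
fstarFuel (suc f) 3 = + 1 ∷ + 0 ∷ + 1 ∷ []
fstarFuel (suc f) 4 = + 1 ∷ + 1 ∷ + 2 ∷ + 0 ∷ + 1 ∷ []
fstarFuel (suc f) (suc (suc (suc (suc (suc m))))) =
  u (ext (fstarFuel f)) (+ (5 ℕ.+ m)) (+ kstar (5 ℕ.+ m))

fstarℕ : ℕ → Poly
fstarℕ m = fstarFuel (suc m) m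

fstar : ℤ → Poly
fstar = ext fstarℕ

{-# OPTIONS --safe #-}
-- Let U = u₂(f*, n+d+2, k₁, k₂). Its coefficients are those of q^(2d+4) f*(n), of the f*-part
-- q^(2k₁+2) f*(k₂) + f*(k₁), and of the S-part q^(2k₁+2) S(k₂, n+k₂+1) + S(k₁, n+d+2).
-- From degree e = 2k₁ + k₂ on, the f*-part coincides with f*(d+1): f*(k₁) has degree < 2k₁,
-- and the recursion for f* makes q² f*(a) agree with f*(a+1) in degrees ≥ a.
-- The S-part is read through its second difference, i.e. after multiplying by (1 - q)², using
-- (1 - q)² S(k, m) = q^k - q^(m-1) - q^(2k+1) + q^(k+m): in degrees ≥ e + 2 this leaves a single
-- q^(e+2) plus terms depending only on n and d. For V = u₂(f*, n+d+2, ℓ₁, ℓ₂) the spike sits at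
-- 2ℓ₁ + ℓ₂ + 2 < e + 2, so (1 - q)² (U - V) is q^(e+2) in degrees ≥ e + 2. As U - V is a
-- polynomial, its coefficients are then 1 at e and 0 above, and a polynomial with leading
-- coefficient 1 is eventually positive.
module Submission where

open import Defs

module Sequences where

  open import Data.Nat using (ℕ; zero; suc; _+_; _∸_; _≤_; _<_; s≤s)
  import Data.Nat.Properties as ℕP
  open import Data.Integer as ℤ using (ℤ; +_)
  import Data.Integer.Properties as ℤP
  open import Data.Integer.Tactic.RingSolver using (solve-∀)
  open import Data.Product using (_×_; _,_; ∃)
  open import Relation.Binary.PropositionalEquality

  Seq : Set
  Seq = ℕ → ℤ

  0ˢ : Seq
  0ˢ _ = + 0

  infixl 6 _⊞_ _⊟_

  _⊞_ : Seq → Seq → Seq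
  (F ⊞ G) j = F j ℤ.+ G j

  _⊟_ : Seq → Seq → Seq
  (F ⊟ G) j = F j ℤ.- G j

  shift : ℕ → Seq → Seq
  shift zero F j = F j
  shift (suc e) F zero = + 0
  shift (suc e) F (suc j) = shift e F j

  δ : ℕ → Seq
  δ zero zero = + 1
  δ zero (suc j) = + 0
  δ (suc a) zero = + 0
  δ (suc a) (suc j) = δ a j

  -- Δ F and ΔΔ F are the coefficient sequences of (1 - q) F and (1 - q)² F.
  Δ : Seq → Seq
  Δ F = F ⊟ shift 1 F

  ΔΔ : Seq → Seq
  ΔΔ F = Δ (Δ F)

  AgreeFrom : ℕ → Seq → Seq → Set
  AgreeFrom c F G = ∀ j → c ≤ j → F j ≡ G j

  VanishesFrom : ℕ → Seq → Set
  VanishesFrom c F = AgreeFrom c F 0ˢ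

  FinitelySupported : Seq → Set
  FinitelySupported F = ∃ λ B → VanishesFrom B F

  agreeFrom-mono : ∀ {c c' F G} → c ≤ c' → AgreeFrom c F G → AgreeFrom c' F G
  agreeFrom-mono c≤c' F≈G j c'≤j = F≈G j (ℕP.≤-trans c≤c' c'≤j)

  agreeFrom-offset : ∀ {c F G} → (∀ i → F (c + i) ≡ G (c + i)) → AgreeFrom c F G
  agreeFrom-offset {c} {F} {G} agree j c≤j = subst (λ x → F x ≡ G x) (ℕP.m+[n∸m]≡n c≤j) (agree (j ∸ c))

  shift-cong : ∀ {F G} e → F ≗ G → shift e F ≗ shift e G
  shift-cong zero F≗G j = F≗G j
  shift-cong (suc e) F≗G zero = refl
  shift-cong (suc e) F≗G (suc j) = shift-cong e F≗G j

  shift-⊞ : ∀ e F G → shift e (F ⊞ G) ≗ shift e F ⊞ shift e G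
  shift-⊞ zero F G j = refl
  shift-⊞ (suc e) F G zero = refl
  shift-⊞ (suc e) F G (suc j) = shift-⊞ e F G j

  shift-⊟ : ∀ e F G → shift e (F ⊟ G) ≗ shift e F ⊟ shift e G
  shift-⊟ zero F G j = refl
  shift-⊟ (suc e) F G zero = refl
  shift-⊟ (suc e) F G (suc j) = shift-⊟ e F G j

  shift-shift : ∀ a b F → shift a (shift b F) ≗ shift (a + b) F
  shift-shift zero b F j = refl
  shift-shift (suc a) b F zero = refl
  shift-shift (suc a) b F (suc j) = shift-shift a b F j

  shift-comm : ∀ a b F → shift a (shift b F) ≗ shift b (shift a F)
  shift-comm a b F j = begin
    shift a (shift b F) j  ≡⟨ shift-shift a b F j ⟩
    shift (a + b) F j      ≡⟨ cong (λ c → shift c F j) (ℕP.+-comm a b) ⟩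
    shift (b + a) F j      ≡⟨ shift-shift b a F j ⟨
    shift b (shift a F) j  ∎
    where open ≡-Reasoning

  shift-δ : ∀ e a → shift e (δ a) ≗ δ (e + a)
  shift-δ zero a j = refl
  shift-δ (suc e) a zero = refl
  shift-δ (suc e) a (suc j) = shift-δ e a j

  shift-agreeFrom : ∀ {c F G} e → AgreeFrom c F G → AgreeFrom (e + c) (shift e F) (shift e G)
  shift-agreeFrom zero F≈G j c≤j = F≈G j c≤j
  shift-agreeFrom (suc e) F≈G (suc j) (s≤s e+c≤j) = shift-agreeFrom e F≈G j e+c≤j

  shift-vanishesFrom : ∀ {c F} e → VanishesFrom c F → VanishesFrom (e + c) (shift e F)
  shift-vanishesFrom zero F≈0 j c≤j = F≈0 j c≤j
  shift-vanishesFrom (suc e) F≈0 (suc j) (s≤s e+c≤j) = shift-vanishesFrom e F≈0 j e+c≤j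

  δ-self : ∀ a → δ a a ≡ + 1
  δ-self zero = refl
  δ-self (suc a) = δ-self a

  δ-above : ∀ {a j} → a < j → δ a j ≡ + 0
  δ-above {zero} {suc j} _ = refl
  δ-above {suc a} {suc j} (s≤s a<j) = δ-above a<j

  Δ-cong : ∀ {F G} → F ≗ G → Δ F ≗ Δ G
  Δ-cong F≗G j = cong₂ ℤ._-_ (F≗G j) (shift-cong 1 F≗G j)

  Δ-⊞ : ∀ F G → Δ (F ⊞ G) ≗ Δ F ⊞ Δ G
  Δ-⊞ F G j = trans (cong (ℤ._-_ ((F ⊞ G) j)) (shift-⊞ 1 F G j)) (interchange (F j) (G j) (shift 1 F j) (shift 1 G j))
    where
    interchange : ∀ a b c d → a ℤ.+ b ℤ.- (c ℤ.+ d) ≡ (a ℤ.- c) ℤ.+ (b ℤ.- d)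
    interchange = solve-∀

  Δ-⊟ : ∀ F G → Δ (F ⊟ G) ≗ Δ F ⊟ Δ G
  Δ-⊟ F G j = trans (cong (ℤ._-_ ((F ⊟ G) j)) (shift-⊟ 1 F G j)) (interchange (F j) (G j) (shift 1 F j) (shift 1 G j))
    where
    interchange : ∀ a b c d → a ℤ.- b ℤ.- (c ℤ.- d) ≡ (a ℤ.- c) ℤ.- (b ℤ.- d)
    interchange = solve-∀

  Δ-shift : ∀ e F → Δ (shift e F) ≗ shift e (Δ F)
  Δ-shift e F j = begin
    shift e F j ℤ.- shift 1 (shift e F) j  ≡⟨ cong (ℤ._-_ (shift e F j)) (shift-comm 1 e F j) ⟩
    shift e F j ℤ.- shift e (shift 1 F) j  ≡⟨ shift-⊟ e F (shift 1 F) j ⟨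
    shift e (Δ F) j                        ∎
    where open ≡-Reasoning

  Δ-0ˢ : ∀ A → Δ 0ˢ ≗ A ⊟ A
  Δ-0ˢ A zero = sym (ℤP.+-inverseʳ (A zero))
  Δ-0ˢ A (suc j) = sym (ℤP.+-inverseʳ (A (suc j)))

  Δ-agreeFrom : ∀ {c F G} → AgreeFrom c F G → AgreeFrom (suc c) (Δ F) (Δ G)
  Δ-agreeFrom F≈G (suc j) (s≤s c≤j) = cong₂ ℤ._-_ (F≈G (suc j) (ℕP.m≤n⇒m≤1+n c≤j)) (F≈G j c≤j)

  ΔΔ-cong : ∀ {F G} → F ≗ G → ΔΔ F ≗ ΔΔ G
  ΔΔ-cong F≗G = Δ-cong (Δ-cong F≗G)

  ΔΔ-⊞ : ∀ F G → ΔΔ (F ⊞ G) ≗ ΔΔ F ⊞ ΔΔ G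
  ΔΔ-⊞ F G j = trans (Δ-cong (Δ-⊞ F G) j) (Δ-⊞ (Δ F) (Δ G) j)

  ΔΔ-⊟ : ∀ F G → ΔΔ (F ⊟ G) ≗ ΔΔ F ⊟ ΔΔ G
  ΔΔ-⊟ F G j = trans (Δ-cong (Δ-⊟ F G) j) (Δ-⊟ (Δ F) (Δ G) j)

  ΔΔ-shift : ∀ e F → ΔΔ (shift e F) ≗ shift e (ΔΔ F)
  ΔΔ-shift e F j = trans (Δ-cong (Δ-shift e F) j) (Δ-shift e (Δ F) j)

  ΔΔ-agreeFrom : ∀ {c F G} → AgreeFrom c F G → AgreeFrom (2 + c) (ΔΔ F) (ΔΔ G)
  ΔΔ-agreeFrom F≈G = Δ-agreeFrom (Δ-agreeFrom F≈G)

  Δ-finite : ∀ {F} → FinitelySupported F → FinitelySupported (Δ F)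
  Δ-finite (B , F≈0) = suc B , λ j B<j → trans (Δ-agreeFrom F≈0 j B<j) (Δ-0ˢ 0ˢ j)

  ⊟-finite : ∀ {F G} → FinitelySupported F → FinitelySupported G → FinitelySupported (F ⊟ G)
  ⊟-finite (a , F≈0) (b , G≈0) = a + b , λ j a+b≤j →
    cong₂ ℤ._-_ (F≈0 j (ℕP.≤-trans (ℕP.m≤m+n a b) a+b≤j)) (G≈0 j (ℕP.≤-trans (ℕP.m≤n+m b a) a+b≤j))

  shift-finite : ∀ {F} e → FinitelySupported F → FinitelySupported (shift e F)
  shift-finite e (B , F≈0) = e + B , shift-vanishesFrom e F≈0

  vanishesFrom-Δ : ∀ {c F} → FinitelySupported F → VanishesFrom (suc c) (Δ F) → VanishesFrom c F
  vanishesFrom-Δ {c} {F} (B , F≈0) ΔF≈0 j c≤j = trans (constant B j c≤j) (F≈0 (B + j) (ℕP.m≤m+n B j))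
    where
    constant : ∀ r j → c ≤ j → F j ≡ F (r + j)
    constant zero j c≤j = refl
    constant (suc r) j c≤j = begin
      F j          ≡⟨ ℤP.i-j≡0⇒i≡j _ _ (ΔF≈0 (suc j) (s≤s c≤j)) ⟨
      F (suc j)    ≡⟨ constant r (suc j) (ℕP.m≤n⇒m≤1+n c≤j) ⟩
      F (r + suc j) ≡⟨ cong F (ℕP.+-suc r j) ⟩
      F (suc r + j) ∎
      where open ≡-Reasoning

  vanishesFrom-ΔΔ : ∀ {c F} → FinitelySupported F → VanishesFrom (2 + c) (ΔΔ F) → VanishesFrom c F
  vanishesFrom-ΔΔ fin ΔΔF≈0 = vanishesFrom-Δ fin (vanishesFrom-Δ (Δ-finite fin) ΔΔF≈0)

  agreeFrom-ΔΔ : ∀ {c F G} → FinitelySupported (F ⊟ G) → AgreeFrom (2 + c) (ΔΔ F) (ΔΔ G) → AgreeFrom c F G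
  agreeFrom-ΔΔ {c} {F} {G} fin ΔΔF≈ΔΔG j c≤j = ℤP.i-j≡0⇒i≡j _ _ (vanishesFrom-ΔΔ fin ΔΔ[F⊟G]≈0 j c≤j)
    where
    ΔΔ[F⊟G]≈0 : VanishesFrom (2 + c) (ΔΔ (F ⊟ G))
    ΔΔ[F⊟G]≈0 j c+2≤j = trans (ΔΔ-⊟ F G j) (ℤP.i≡j⇒i-j≡0 (ΔΔF≈ΔΔG j c+2≤j))

  leadingOne-from-ΔΔ : ∀ {e F} → FinitelySupported F → AgreeFrom (2 + e) (ΔΔ F) (δ (2 + e)) →
    (F e ≡ + 1) × VanishesFrom (suc e) F
  leadingOne-from-ΔΔ {e} {F} fin ΔΔF≈δ = Fe≡1 , F≈0
    where
    ΔF≈0 : VanishesFrom (2 + e) (Δ F)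
    ΔF≈0 = vanishesFrom-Δ (Δ-finite fin) (λ j 3+e≤j → trans (ΔΔF≈δ j (ℕP.<⇒≤ 3+e≤j)) (δ-above 3+e≤j))
    F≈0 : VanishesFrom (suc e) F
    F≈0 = vanishesFrom-Δ fin ΔF≈0
    negate : ∀ x → x ≡ ℤ.- (+ 0 ℤ.- x)
    negate = solve-∀
    ΔF[1+e]≡-1 : Δ F (suc e) ≡ ℤ.- + 1
    ΔF[1+e]≡-1 = begin
      Δ F (suc e)                              ≡⟨ negate (Δ F (suc e)) ⟩
      ℤ.- (+ 0 ℤ.- Δ F (suc e))               ≡⟨ cong (λ x → ℤ.- (x ℤ.- Δ F (suc e))) (ΔF≈0 (2 + e) ℕP.≤-refl) ⟨
      ℤ.- (Δ F (2 + e) ℤ.- Δ F (suc e))        ≡⟨ cong ℤ.-_ (trans (ΔΔF≈δ (2 + e) ℕP.≤-refl) (δ-self (2 + e))) ⟩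
      ℤ.- + 1                                  ∎
      where open ≡-Reasoning
    Fe≡1 : F e ≡ + 1
    Fe≡1 = begin
      F e                          ≡⟨ negate (F e) ⟩
      ℤ.- (+ 0 ℤ.- F e)            ≡⟨ cong (λ x → ℤ.- (x ℤ.- F e)) (F≈0 (suc e) ℕP.≤-refl) ⟨
      ℤ.- (F (suc e) ℤ.- F e)      ≡⟨ cong ℤ.-_ ΔF[1+e]≡-1 ⟩
      ℤ.- ℤ.- + 1                  ≡⟨⟩
      + 1                          ∎
      where open ≡-Reasoning

module Coefficients where

  open Sequences
  open import Data.Nat using (zero; suc; _+_; s≤s)
  import Data.Nat.Properties as ℕP
  open import Data.Integer as ℤ using (ℤ; +_)
  import Data.Integer.Properties as ℤP
  open import Data.Integer.Tactic.RingSolver using (solve-∀)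
  open import Data.List using ([]; _∷_; map; length)
  open import Data.Product using (_,_)
  open import Relation.Binary.PropositionalEquality

  coeff-vanishes : ∀ p → VanishesFrom (length p) (coeff p)
  coeff-vanishes [] j _ = refl
  coeff-vanishes (a ∷ p) (suc j) (s≤s len≤j) = coeff-vanishes p j len≤j

  coeff-finite : ∀ p → FinitelySupported (coeff p)
  coeff-finite p = length p , coeff-vanishes p

  coeff-⊕ : ∀ p q → coeff (p ⊕ q) ≗ coeff p ⊞ coeff q
  coeff-⊕ [] q j = sym (ℤP.+-identityˡ (coeff q j))
  coeff-⊕ (a ∷ p) [] j = sym (ℤP.+-identityʳ (coeff (a ∷ p) j))
  coeff-⊕ (a ∷ p) (b ∷ q) zero = refl
  coeff-⊕ (a ∷ p) (b ∷ q) (suc j) = coeff-⊕ p q j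

  coeff-neg : ∀ p j → coeff (neg p) j ≡ ℤ.- coeff p j
  coeff-neg [] j = refl
  coeff-neg (a ∷ p) zero = refl
  coeff-neg (a ∷ p) (suc j) = coeff-neg p j

  coeff-⊕-neg : ∀ p q → coeff (p ⊕ neg q) ≗ coeff p ⊟ coeff q
  coeff-⊕-neg p q j = trans (coeff-⊕ p (neg q) j) (cong (ℤ._+_ (coeff p j)) (coeff-neg q j))

  coeff-X^ : ∀ e → coeff (X^ e) ≗ δ e
  coeff-X^ zero zero = refl
  coeff-X^ zero (suc j) = refl
  coeff-X^ (suc e) zero = refl
  coeff-X^ (suc e) (suc j) = coeff-X^ e j

  coeff-∷⊗ : ∀ a p r j → coeff ((a ∷ p) ⊗ r) j ≡ a ℤ.* coeff r j ℤ.+ shift 1 (coeff (p ⊗ r)) j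
  coeff-∷⊗ a p r j = trans (coeff-⊕ (map (a ℤ.*_) r) (+ 0 ∷ (p ⊗ r)) j) (cong₂ ℤ._+_ (coeff-map r j) (coeff-cons0 j))
    where
    coeff-map : ∀ r j → coeff (map (a ℤ.*_) r) j ≡ a ℤ.* coeff r j
    coeff-map [] j = sym (ℤP.*-zeroʳ a)
    coeff-map (b ∷ r) zero = refl
    coeff-map (b ∷ r) (suc j) = coeff-map r j
    coeff-cons0 : ∀ j → coeff (+ 0 ∷ (p ⊗ r)) j ≡ shift 1 (coeff (p ⊗ r)) j
    coeff-cons0 zero = refl
    coeff-cons0 (suc j) = refl

  coeff-X^⊗ : ∀ e p → coeff (X^ e ⊗ p) ≗ shift e (coeff p)
  coeff-X^⊗ zero p j = begin
    coeff ((+ 1 ∷ []) ⊗ p) j                       ≡⟨ coeff-∷⊗ (+ 1) [] p j ⟩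
    + 1 ℤ.* coeff p j ℤ.+ shift 1 (coeff []) j     ≡⟨ cong (ℤ._+_ (+ 1 ℤ.* coeff p j)) (shift-0ˢ j) ⟩
    + 1 ℤ.* coeff p j ℤ.+ + 0                      ≡⟨ ℤP.+-identityʳ _ ⟩
    + 1 ℤ.* coeff p j                              ≡⟨ ℤP.*-identityˡ _ ⟩
    coeff p j                                      ∎
    where
    open ≡-Reasoning
    shift-0ˢ : shift 1 0ˢ ≗ 0ˢ
    shift-0ˢ zero = refl
    shift-0ˢ (suc j) = refl
  coeff-X^⊗ (suc e) p zero = coeff-∷⊗ (+ 0) (X^ e) p zero
  coeff-X^⊗ (suc e) p (suc j) = begin
    coeff (X^ (suc e) ⊗ p) (suc j)                  ≡⟨ coeff-∷⊗ (+ 0) (X^ e) p (suc j) ⟩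
    + 0 ℤ.* coeff p (suc j) ℤ.+ coeff (X^ e ⊗ p) j  ≡⟨ ℤP.+-identityˡ _ ⟩
    coeff (X^ e ⊗ p) j                              ≡⟨ coeff-X^⊗ e p j ⟩
    shift e (coeff p) j                             ∎
    where open ≡-Reasoning

  coeff-⊗-distribʳ : ∀ p p' r → coeff ((p ⊕ p') ⊗ r) ≗ coeff (p ⊗ r) ⊞ coeff (p' ⊗ r)
  coeff-⊗-distribʳ [] p' r j = sym (ℤP.+-identityˡ _)
  coeff-⊗-distribʳ (a ∷ p) [] r j = sym (ℤP.+-identityʳ _)
  coeff-⊗-distribʳ (a ∷ p) (b ∷ p') r j = begin
    coeff (((a ℤ.+ b) ∷ (p ⊕ p')) ⊗ r) j
      ≡⟨ coeff-∷⊗ (a ℤ.+ b) (p ⊕ p') r j ⟩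
    (a ℤ.+ b) ℤ.* coeff r j ℤ.+ shift 1 (coeff ((p ⊕ p') ⊗ r)) j
      ≡⟨ cong (ℤ._+_ ((a ℤ.+ b) ℤ.* coeff r j)) (trans (shift-cong 1 (coeff-⊗-distribʳ p p' r) j) (shift-⊞ 1 _ _ j)) ⟩
    (a ℤ.+ b) ℤ.* coeff r j ℤ.+ (shift 1 (coeff (p ⊗ r)) j ℤ.+ shift 1 (coeff (p' ⊗ r)) j)
      ≡⟨ distrib a b (coeff r j) _ _ ⟩
    (a ℤ.* coeff r j ℤ.+ shift 1 (coeff (p ⊗ r)) j) ℤ.+ (b ℤ.* coeff r j ℤ.+ shift 1 (coeff (p' ⊗ r)) j)
      ≡⟨ cong₂ ℤ._+_ (coeff-∷⊗ a p r j) (coeff-∷⊗ b p' r j) ⟨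
    coeff ((a ∷ p) ⊗ r) j ℤ.+ coeff ((b ∷ p') ⊗ r) j
      ∎
    where
    open ≡-Reasoning
    distrib : ∀ a b c x y → (a ℤ.+ b) ℤ.* c ℤ.+ (x ℤ.+ y) ≡ (a ℤ.* c ℤ.+ x) ℤ.+ (b ℤ.* c ℤ.+ y)
    distrib = solve-∀

  coeff-step : ∀ c A B C → coeff (X^ c ⊗ A ⊕ B ⊕ C) ≗ shift c (coeff A) ⊞ coeff B ⊞ coeff C
  coeff-step c A B C j = begin
    coeff (X^ c ⊗ A ⊕ B ⊕ C) j                           ≡⟨ coeff-⊕ (X^ c ⊗ A ⊕ B) C j ⟩
    coeff (X^ c ⊗ A ⊕ B) j ℤ.+ coeff C j                 ≡⟨ cong (ℤ._+ coeff C j) (coeff-⊕ (X^ c ⊗ A) B j) ⟩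
    coeff (X^ c ⊗ A) j ℤ.+ coeff B j ℤ.+ coeff C j       ≡⟨ cong (λ x → x ℤ.+ coeff B j ℤ.+ coeff C j) (coeff-X^⊗ c A j) ⟩
    shift c (coeff A) j ℤ.+ coeff B j ℤ.+ coeff C j      ∎
    where open ≡-Reasoning

  telescope : ∀ a b c → (a ℤ.- b) ℤ.+ (b ℤ.- c) ≡ a ℤ.- c
  telescope = solve-∀


  Δ-coeff-geomFrom : ∀ a L → Δ (coeff (geomFrom a L)) ≗ δ a ⊟ δ (a + L)
  Δ-coeff-geomFrom a zero j = trans (Δ-0ˢ (δ a) j) (cong (λ b → δ a j ℤ.- δ b j) (sym (ℕP.+-identityʳ a)))
  Δ-coeff-geomFrom a (suc L) j = begin
    Δ (coeff (X^ a ⊕ geomFrom (suc a) L)) j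
      ≡⟨ Δ-cong split j ⟩
    Δ (δ a ⊞ G) j
      ≡⟨ Δ-⊞ (δ a) G j ⟩
    Δ (δ a) j ℤ.+ Δ G j
      ≡⟨ cong₂ ℤ._+_ (cong (ℤ._-_ (δ a j)) (shift-δ 1 a j)) (Δ-coeff-geomFrom (suc a) L j) ⟩
    (δ a j ℤ.- δ (suc a) j) ℤ.+ (δ (suc a) j ℤ.- δ (suc a + L) j)
      ≡⟨ telescope (δ a j) (δ (suc a) j) (δ (suc a + L) j) ⟩
    δ a j ℤ.- δ (suc a + L) j
      ≡⟨ cong (λ b → δ a j ℤ.- δ b j) (ℕP.+-suc a L) ⟨
    δ a j ℤ.- δ (a + suc L) j
      ∎
    where
    open ≡-Reasoning
    G = coeff (geomFrom (suc a) L)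
    split : coeff (X^ a ⊕ geomFrom (suc a) L) ≗ δ a ⊞ G
    split i = trans (coeff-⊕ (X^ a) _ i) (cong (ℤ._+ G i) (coeff-X^ a i))

  Δ-coeff-geomFrom⊗ : ∀ a L p → Δ (coeff (geomFrom a L ⊗ p)) ≗ shift a (coeff p) ⊟ shift (a + L) (coeff p)
  Δ-coeff-geomFrom⊗ a zero p j =
    trans (Δ-0ˢ (shift a (coeff p)) j) (cong (λ b → shift a (coeff p) j ℤ.- shift b (coeff p) j) (sym (ℕP.+-identityʳ a)))
  Δ-coeff-geomFrom⊗ a (suc L) p j = begin
    Δ (coeff ((X^ a ⊕ geomFrom (suc a) L) ⊗ p)) j
      ≡⟨ Δ-cong split j ⟩
    Δ (shift a P ⊞ G) j
      ≡⟨ Δ-⊞ (shift a P) G j ⟩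
    Δ (shift a P) j ℤ.+ Δ G j
      ≡⟨ cong₂ ℤ._+_ (cong (ℤ._-_ (shift a P j)) (shift-shift 1 a P j)) (Δ-coeff-geomFrom⊗ (suc a) L p j) ⟩
    (shift a P j ℤ.- shift (suc a) P j) ℤ.+ (shift (suc a) P j ℤ.- shift (suc a + L) P j)
      ≡⟨ telescope (shift a P j) (shift (suc a) P j) (shift (suc a + L) P j) ⟩
    shift a P j ℤ.- shift (suc a + L) P j
      ≡⟨ cong (λ b → shift a P j ℤ.- shift b P j) (ℕP.+-suc a L) ⟨
    shift a P j ℤ.- shift (a + suc L) P j
      ∎
    where
    open ≡-Reasoning
    P = coeff p
    G = coeff (geomFrom (suc a) L ⊗ p)
    split : coeff ((X^ a ⊕ geomFrom (suc a) L) ⊗ p) ≗ shift a P ⊞ G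
    split i = trans (coeff-⊗-distribʳ (X^ a) _ p i) (cong (ℤ._+ G i) (coeff-X^⊗ a p i))

module PowerOfTwoOffset where

  open import Data.Nat
  open import Data.Nat.Properties
  open import Data.Nat.Logarithm using (⌊log₂_⌋; ⌊log₂⌋-mono-≤; ⌊log₂[2^n]⌋≡n)
  open import Relation.Binary.PropositionalEquality
  open import Relation.Nullary using (yes; no; contradiction)

  2*n≡n+n : ∀ n → 2 * n ≡ n + n
  2*n≡n+n n = cong (n +_) (+-identityʳ n)

  n<2^[1+⌊log₂n⌋] : ∀ n → n < 2 ^ suc ⌊log₂ n ⌋
  n<2^[1+⌊log₂n⌋] n with 2 ^ suc ⌊log₂ n ⌋ ≤? n
  ... | no 2^L≰n = ≰⇒> 2^L≰n
  ... | yes 2^L≤n =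
    contradiction (subst (_≤ ⌊log₂ n ⌋) (⌊log₂[2^n]⌋≡n (suc ⌊log₂ n ⌋)) (⌊log₂⌋-mono-≤ 2^L≤n)) (<-irrefl refl)

  kstar-double< : ∀ a → 0 < a → 2 * kstar a < a
  kstar-double< a 0<a with 2 ^ ⌊log₂ a ⌋ ≤? a
  ... | no 2^L≰a rewrite m≤n⇒m∸n≡0 (<⇒≤ (≰⇒> 2^L≰a)) = 0<a
  ... | yes 2^L≤a = begin-strict
    2 * k      ≡⟨ 2*n≡n+n k ⟩
    k + k      <⟨ +-monoˡ-< k k<P ⟩
    P + k      ≡⟨ m+[n∸m]≡n 2^L≤a ⟩
    a          ∎
    where
    open ≤-Reasoning
    P = 2 ^ ⌊log₂ a ⌋
    k = a ∸ P
    k<P : k < P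
    k<P = +-cancelˡ-< P k P (begin-strict
      P + k      ≡⟨ m+[n∸m]≡n 2^L≤a ⟩
      a          <⟨ n<2^[1+⌊log₂n⌋] a ⟩
      2 * P      ≡⟨ 2*n≡n+n P ⟩
      P + P      ∎)

  kstar-pred : ∀ a k → kstar (suc a) ≡ suc k → kstar a ≡ k
  kstar-pred a k k*[1+a]≡1+k = suc-injective (trans (sym 1+a∸P≡1+k*a) k*[1+a]≡1+k)
    where
    L = ⌊log₂ suc a ⌋
    P = 2 ^ L
    P≤a : P ≤ a
    P≤a with P ≤? a
    ... | yes P≤a = P≤a
    ... | no P≰a with () ← trans (sym (m≤n⇒m∸n≡0 (≰⇒> P≰a))) k*[1+a]≡1+k
    ⌊log₂a⌋≡L : ⌊log₂ a ⌋ ≡ L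
    ⌊log₂a⌋≡L = ≤-antisym (⌊log₂⌋-mono-≤ (n≤1+n a))
                          (subst (_≤ ⌊log₂ a ⌋) (⌊log₂[2^n]⌋≡n L) (⌊log₂⌋-mono-≤ P≤a))
    1+a∸P≡1+k*a : suc a ∸ P ≡ suc (kstar a)
    1+a∸P≡1+k*a = trans (+-∸-assoc 1 P≤a) (cong (λ L → suc (a ∸ 2 ^ L)) (sym ⌊log₂a⌋≡L))

  rest : ℕ → ℕ
  rest a = a ∸ suc (kstar a)

  kstar-split : ∀ a → 0 < a → a ≡ suc (kstar a) + rest a
  kstar-split a 0<a = sym (m+[n∸m]≡n (≤-trans (s≤s (m≤n*m (kstar a) 2)) (kstar-double< a 0<a)))

module FStarCoefficients where

  open Sequences
  open Coefficients
  open PowerOfTwoOffset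
  open import Data.Nat using (ℕ; zero; suc; _+_; _*_; _≤_; _<_; z≤n; s≤s)
  import Data.Nat.Properties as ℕP
  open import Data.Integer as ℤ using (ℤ; +_; -[1+_]; ∣_∣)
  import Data.Integer.Properties as ℤP
  import Data.Integer.Tactic.RingSolver as ℤ-Solver
  open import Data.List using ([]; length)
  open import Data.Nat.Induction using (<-rec)
  import Data.Nat.Tactic.RingSolver as ℕ-Solver
  open import Data.Product using (_,_; _×_; proj₁; proj₂)
  open import Relation.Binary.PropositionalEquality

  Sgeom : ℕ → ℕ → Poly
  Sgeom K L = geomFrom 0 (suc K) ⊗ geomFrom K L

  rangeSum-geomFrom : ∀ a b L → b ℤ.- + a ℤ.+ + 1 ≡ + L → rangeSum a b ≡ geomFrom a L
  rangeSum-geomFrom a b L len with b ℤ.- + a ℤ.+ + 1 | len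
  ... | .(+ L) | refl = refl

  S-Sgeom : ∀ K m L → m ℤ.- + 2 ℤ.- + K ℤ.+ + 1 ≡ + L → S (+ K) m ≡ Sgeom K L
  S-Sgeom K m L len = cong₂ _⊗_ (rangeSum-geomFrom 0 (+ K) (suc K) (suc-len (+ K))) (rangeSum-geomFrom K (m ℤ.- + 2) L len)
    where
    suc-len : ∀ k → k ℤ.- + 0 ℤ.+ + 1 ≡ + 1 ℤ.+ k
    suc-len = ℤ-Solver.solve-∀

  ∣2K+2∣ : ∀ K → ∣ + 2 ℤ.* + K ℤ.+ + 2 ∣ ≡ 2 * K + 2
  ∣2K+2∣ K = cong (λ i → ∣ i ℤ.+ + 2 ∣) (ℤP.+◃n≡+n (2 * K))

  step-ℕ : ∀ (A : ℤ → Poly) B K P →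
    X^ ∣ + 2 ℤ.* + K ℤ.+ + 2 ∣ ⊗ A (+ (suc K + P) ℤ.- + K ℤ.- + 1) ⊕ B ⊕ S (+ K) (+ (suc K + P))
    ≡ X^ (2 * K + 2) ⊗ A (+ P) ⊕ B ⊕ Sgeom K P
  step-ℕ A B K P = cong₃ (λ e a s → X^ e ⊗ a ⊕ B ⊕ s)
    (∣2K+2∣ K) (cong A (remainder (+ K) (+ P))) (S-Sgeom K (+ (suc K + P)) P (range-length (+ K) (+ P)))
    where
    cong₃ : ∀ {A B C D : Set} (f : A → B → C → D) {a a' b b' c c'} → a ≡ a' → b ≡ b' → c ≡ c' → f a b c ≡ f a' b' c'
    cong₃ f refl refl refl = refl
    remainder : ∀ k p → + 1 ℤ.+ k ℤ.+ p ℤ.- k ℤ.- + 1 ≡ p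
    remainder = ℤ-Solver.solve-∀
    range-length : ∀ k p → + 1 ℤ.+ k ℤ.+ p ℤ.- + 2 ℤ.- k ℤ.+ + 1 ≡ p
    range-length = ℤ-Solver.solve-∀

  u-ℕ : ∀ φ K P → u φ (+ (suc K + P)) (+ K) ≡ X^ (2 * K + 2) ⊗ φ (+ P) ⊕ φ (+ K) ⊕ Sgeom K P
  u-ℕ φ K P = step-ℕ φ (φ (+ K)) K P

  u₂-ℕ : ∀ φ K₁ K₂ N → u₂ φ (+ (suc K₁ + (suc K₂ + N))) (+ K₁) (+ K₂)
    ≡ X^ (2 * K₁ + 2) ⊗ (X^ (2 * K₂ + 2) ⊗ φ (+ N) ⊕ φ (+ K₂) ⊕ Sgeom K₂ N) ⊕ φ (+ K₁) ⊕ Sgeom K₁ (suc K₂ + N)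
  u₂-ℕ φ K₁ K₂ N = trans (step-ℕ (λ M → u φ M (+ K₂)) (φ (+ K₁)) K₁ (suc K₂ + N))
    (cong (λ A → X^ (2 * K₁ + 2) ⊗ A ⊕ φ (+ K₁) ⊕ Sgeom K₁ (suc K₂ + N)) (u-ℕ φ K₂ N))

  fᶜ : ℕ → Seq
  fᶜ a = coeff (fstarℕ a)

  Sᶜ : ℕ → ℕ → Seq
  Sᶜ K L = coeff (Sgeom K L)

  fstarFuel-unfold : ∀ f a k P → 5 ≤ a → kstar a ≡ k → a ≡ suc k + P →
    fstarFuel (suc f) a ≡ X^ (2 * k + 2) ⊗ fstarFuel f P ⊕ fstarFuel f k ⊕ Sgeom k P
  fstarFuel-unfold f a@(suc (suc (suc (suc (suc _))))) k P (s≤s (s≤s (s≤s (s≤s (s≤s _))))) refl a≡ =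
    trans (cong (λ x → u (ext (fstarFuel f)) (+ x) (+ k)) a≡) (u-ℕ (ext (fstarFuel f)) k P)

  split-< : ∀ {a} k P → a ≡ suc k + P → k < a × P < a
  split-< k P refl = s≤s (ℕP.m≤m+n k P) , s≤s (ℕP.m≤n+m P k)

  fstarFuel-irrelevant : ∀ f g a → a < f → a < g → fstarFuel f a ≡ fstarFuel g a
  fstarFuel-irrelevant (suc f) (suc g) 0 _ _ = refl
  fstarFuel-irrelevant (suc f) (suc g) 1 _ _ = refl
  fstarFuel-irrelevant (suc f) (suc g) 2 _ _ = refl
  fstarFuel-irrelevant (suc f) (suc g) 3 _ _ = refl
  fstarFuel-irrelevant (suc f) (suc g) 4 _ _ = refl
  fstarFuel-irrelevant (suc f) (suc g) a@(suc (suc (suc (suc (suc n))))) (s≤s a≤f) (s≤s a≤g) =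
    begin
      fstarFuel (suc f) a
    ≡⟨ fstarFuel-unfold f a k P 5≤a refl a≡ ⟩
      X^ (2 * k + 2) ⊗ fstarFuel f P ⊕ fstarFuel f k ⊕ Sgeom k P
    ≡⟨ cong₂ (λ x y → X^ (2 * k + 2) ⊗ x ⊕ y ⊕ Sgeom k P) (irrelevant P<a) (irrelevant k<a) ⟩
      X^ (2 * k + 2) ⊗ fstarFuel g P ⊕ fstarFuel g k ⊕ Sgeom k P
    ≡⟨ fstarFuel-unfold g a k P 5≤a refl a≡ ⟨
      fstarFuel (suc g) a
    ∎
    where
    open ≡-Reasoning
    5≤a : 5 ≤ a
    5≤a = ℕP.m≤m+n 5 n
    k = kstar a
    P = rest a
    a≡ = kstar-split a (s≤s z≤n)
    k<a = proj₁ (split-< k P a≡)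
    P<a = proj₂ (split-< k P a≡)
    irrelevant : ∀ {b} → b < a → fstarFuel f b ≡ fstarFuel g b
    irrelevant b<a = fstarFuel-irrelevant f g _ (ℕP.<-≤-trans b<a a≤f) (ℕP.<-≤-trans b<a a≤g)

  fᶜ-unfold : ∀ a k P → 5 ≤ a → kstar a ≡ k → a ≡ suc k + P → fᶜ a ≗ shift (2 * k + 2) (fᶜ P) ⊞ fᶜ k ⊞ Sᶜ k P
  fᶜ-unfold a k P 5≤a k*a≡k a≡ j = trans (cong (λ p → coeff p j) fstarℕ-unfold) (coeff-step (2 * k + 2) _ _ _ j)
    where
    k<a = proj₁ (split-< k P a≡)
    P<a = proj₂ (split-< k P a≡)
    fstarℕ-unfold : fstarℕ a ≡ X^ (2 * k + 2) ⊗ fstarℕ P ⊕ fstarℕ k ⊕ Sgeom k P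
    fstarℕ-unfold = trans (fstarFuel-unfold a a k P 5≤a k*a≡k a≡)
      (cong₂ (λ x y → X^ (2 * k + 2) ⊗ x ⊕ y ⊕ Sgeom k P)
        (fstarFuel-irrelevant a (suc P) P P<a (ℕP.n<1+n P)) (fstarFuel-irrelevant a (suc k) k k<a (ℕP.n<1+n k)))

  coeff-u₂-fstar : ∀ N K₁ K₂ → coeff (u₂ fstar (+ (N + (K₁ + K₂) + 2)) (+ K₁) (+ K₂))
    ≗ shift (2 * K₁ + 2) (shift (2 * K₂ + 2) (fᶜ N) ⊞ fᶜ K₂ ⊞ Sᶜ K₂ N) ⊞ fᶜ K₁ ⊞ Sᶜ K₁ (suc K₂ + N)
  coeff-u₂-fstar N K₁ K₂ j = begin
    coeff (u₂ fstar (+ (N + (K₁ + K₂) + 2)) (+ K₁) (+ K₂)) j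
      ≡⟨ cong (λ m → coeff (u₂ fstar (+ m) (+ K₁) (+ K₂)) j) (m≡ N K₁ K₂) ⟩
    coeff (u₂ fstar (+ (suc K₁ + (suc K₂ + N))) (+ K₁) (+ K₂)) j
      ≡⟨ cong (λ p → coeff p j) (u₂-ℕ fstar K₁ K₂ N) ⟩
    coeff (X^ (2 * K₁ + 2) ⊗ inner ⊕ fstarℕ K₁ ⊕ Sgeom K₁ (suc K₂ + N)) j
      ≡⟨ coeff-step (2 * K₁ + 2) inner (fstarℕ K₁) (Sgeom K₁ (suc K₂ + N)) j ⟩
    shift (2 * K₁ + 2) (coeff inner) j ℤ.+ fᶜ K₁ j ℤ.+ Sᶜ K₁ (suc K₂ + N) j
      ≡⟨ cong (λ x → x ℤ.+ fᶜ K₁ j ℤ.+ Sᶜ K₁ (suc K₂ + N) j)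
           (shift-cong (2 * K₁ + 2) (coeff-step (2 * K₂ + 2) (fstarℕ N) (fstarℕ K₂) (Sgeom K₂ N)) j) ⟩
    shift (2 * K₁ + 2) (shift (2 * K₂ + 2) (fᶜ N) ⊞ fᶜ K₂ ⊞ Sᶜ K₂ N) j ℤ.+ fᶜ K₁ j ℤ.+ Sᶜ K₁ (suc K₂ + N) j
      ∎
    where
    open ≡-Reasoning
    inner = X^ (2 * K₂ + 2) ⊗ fstarℕ N ⊕ fstarℕ K₂ ⊕ Sgeom K₂ N
    m≡ : ∀ N K₁ K₂ → N + (K₁ + K₂) + 2 ≡ suc K₁ + (suc K₂ + N)
    m≡ = ℕ-Solver.solve-∀

  coeff-u₂-fstar-minus-one : ∀ N D → coeff (u₂ fstar (+ (N + D + 2)) -[1+ 0 ] (+ suc D))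
    ≗ shift (2 * D + 4) (fᶜ N) ⊞ fᶜ (suc D) ⊞ Sᶜ (suc D) N
  coeff-u₂-fstar-minus-one N D j = begin
    coeff (u₂ fstar (+ (N + D + 2)) -[1+ 0 ] (+ suc D)) j
      ≡⟨ coeff-step 0 (u fstar M (+ suc D)) [] [] j ⟩
    coeff (u fstar M (+ suc D)) j ℤ.+ + 0 ℤ.+ + 0
      ≡⟨ trans (ℤP.+-identityʳ _) (ℤP.+-identityʳ _) ⟩
    coeff (u fstar M (+ suc D)) j
      ≡⟨ cong (λ m → coeff (u fstar m (+ suc D)) j) M≡ ⟩
    coeff (u fstar (+ (suc (suc D) + N)) (+ suc D)) j
      ≡⟨ cong (λ p → coeff p j) (u-ℕ fstar (suc D) N) ⟩
    coeff (X^ (2 * suc D + 2) ⊗ fstarℕ N ⊕ fstarℕ (suc D) ⊕ Sgeom (suc D) N) j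
      ≡⟨ coeff-step (2 * suc D + 2) (fstarℕ N) (fstarℕ (suc D)) (Sgeom (suc D) N) j ⟩
    shift (2 * suc D + 2) (fᶜ N) j ℤ.+ fᶜ (suc D) j ℤ.+ Sᶜ (suc D) N j
      ≡⟨ cong (λ e → shift e (fᶜ N) j ℤ.+ fᶜ (suc D) j ℤ.+ Sᶜ (suc D) N j) (exponent D) ⟩
    shift (2 * D + 4) (fᶜ N) j ℤ.+ fᶜ (suc D) j ℤ.+ Sᶜ (suc D) N j
      ∎
    where
    open ≡-Reasoning
    M = + (N + D + 2) ℤ.- -[1+ 0 ] ℤ.- + 1
    M≡ : M ≡ + (suc (suc D) + N)
    M≡ = trans (undo (+ (N + D + 2))) (cong +_ (reorder N D))
      where
      undo : ∀ m → m ℤ.- (ℤ.- + 1) ℤ.- + 1 ≡ m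
      undo = ℤ-Solver.solve-∀
      reorder : ∀ N D → N + D + 2 ≡ suc (suc D) + N
      reorder = ℕ-Solver.solve-∀
    exponent : ∀ D → 2 * suc D + 2 ≡ 2 * D + 4
    exponent = ℕ-Solver.solve-∀

  ΔΔ-Sᶜ : ∀ K L → ΔΔ (Sᶜ K L) ≗ (δ K ⊟ δ (K + L)) ⊟ (δ (suc K + K) ⊟ δ (suc K + (K + L)))
  ΔΔ-Sᶜ K L j = begin
    ΔΔ (Sᶜ K L) j                                ≡⟨ Δ-cong (Δ-coeff-geomFrom⊗ 0 (suc K) (geomFrom K L)) j ⟩
    Δ (Y ⊟ shift (suc K) Y) j                    ≡⟨ Δ-⊟ Y (shift (suc K) Y) j ⟩
    Δ Y j ℤ.- Δ (shift (suc K) Y) j              ≡⟨ cong (ℤ._-_ (Δ Y j)) (Δ-shift (suc K) Y j) ⟩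
    Δ Y j ℤ.- shift (suc K) (Δ Y) j
      ≡⟨ cong₂ ℤ._-_ (Δ-coeff-geomFrom K L j) (shift-cong (suc K) (Δ-coeff-geomFrom K L) j) ⟩
    (δ K j ℤ.- δ (K + L) j) ℤ.- shift (suc K) (δ K ⊟ δ (K + L)) j
      ≡⟨ cong (ℤ._-_ (δ K j ℤ.- δ (K + L) j)) (trans (shift-⊟ (suc K) (δ K) (δ (K + L)) j)
           (cong₂ ℤ._-_ (shift-δ (suc K) K j) (shift-δ (suc K) (K + L) j))) ⟩
    (δ K j ℤ.- δ (K + L) j) ℤ.- (δ (suc K + K) j ℤ.- δ (suc K + (K + L)) j) ∎
    where
    open ≡-Reasoning
    Y = coeff (geomFrom K L)

  Sᶜ-vanishes : ∀ K L → VanishesFrom (K + (K + L)) (Sᶜ K L)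
  Sᶜ-vanishes K L = vanishesFrom-ΔΔ (coeff-finite (Sgeom K L)) λ j 2+top≤j → trans (ΔΔ-Sᶜ K L j)
    (cong₂ ℤ._-_ (cong₂ ℤ._-_ (below 2+top≤j (ℕP.m≤n⇒m≤1+n (ℕP.m≤m+n K (K + L))))
                              (below 2+top≤j (ℕP.m≤n⇒m≤1+n (ℕP.m≤n+m (K + L) K))))
                 (cong₂ ℤ._-_ (below 2+top≤j (s≤s (ℕP.+-monoʳ-≤ K (ℕP.m≤m+n K L))))
                              (below 2+top≤j ℕP.≤-refl)))
    where
    below : ∀ {j x} → 2 + (K + (K + L)) ≤ j → x ≤ suc (K + (K + L)) → δ x j ≡ + 0
    below 2+top≤j x≤1+top = δ-above (ℕP.<-≤-trans (s≤s x≤1+top) 2+top≤j)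

  Sᶜ-stable : ∀ K P → AgreeFrom (suc K + P) (Sᶜ (suc K) P) (shift 2 (Sᶜ K P))
  Sᶜ-stable K P = agreeFrom-ΔΔ (⊟-finite (coeff-finite (Sgeom (suc K) P)) (shift-finite 2 (coeff-finite (Sgeom K P)))) ΔΔ-agree
    where
    ΔΔ-agree : AgreeFrom (2 + (suc K + P)) (ΔΔ (Sᶜ (suc K) P)) (ΔΔ (shift 2 (Sᶜ K P)))
    ΔΔ-agree (suc (suc i)) (s≤s (s≤s K+P<i)) = begin
      ΔΔ (Sᶜ (suc K) P) (2 + i)
        ≡⟨ ΔΔ-Sᶜ (suc K) P (2 + i) ⟩
      (δ K (suc i) ℤ.- δ (K + P) (suc i)) ℤ.- (δ (K + suc K) i ℤ.- δ (K + (suc K + P)) i)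
        ≡⟨ cong₂ ℤ._-_ (cong₂ ℤ._-_ (δ-above (ℕP.m≤n⇒m≤1+n K<i)) (δ-above (ℕP.m≤n⇒m≤1+n K+P<i)))
                       (cong₂ ℤ._-_ (cong (λ x → δ x i) (ℕP.+-suc K K)) (cong (λ x → δ x i) (ℕP.+-suc K (K + P)))) ⟩
      (+ 0 ℤ.- + 0) ℤ.- (δ (suc K + K) i ℤ.- δ (suc K + (K + P)) i)
        ≡⟨ cong₂ ℤ._-_ (cong₂ ℤ._-_ (δ-above K<i) (δ-above K+P<i)) refl ⟨
      (δ K i ℤ.- δ (K + P) i) ℤ.- (δ (suc K + K) i ℤ.- δ (suc K + (K + P)) i)
        ≡⟨ ΔΔ-Sᶜ K P i ⟨
      ΔΔ (Sᶜ K P) i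
        ≡⟨ ΔΔ-shift 2 (Sᶜ K P) (2 + i) ⟨
      ΔΔ (shift 2 (Sᶜ K P)) (2 + i) ∎
      where
      open ≡-Reasoning
      K<i : K < i
      K<i = ℕP.≤-<-trans (ℕP.m≤m+n K P) K+P<i

  fᶜ-vanishes : ∀ a → VanishesFrom (2 * a) (fᶜ a)
  fᶜ-vanishes = <-rec (λ a → VanishesFrom (2 * a) (fᶜ a)) vanishes
    where
    small : ∀ a → length (fstarℕ a) ≤ 2 * a → VanishesFrom (2 * a) (fᶜ a)
    small a len≤2a = agreeFrom-mono len≤2a (coeff-vanishes (fstarℕ a))
    vanishes : ∀ a → (∀ {b} → b < a → VanishesFrom (2 * b) (fᶜ b)) → VanishesFrom (2 * a) (fᶜ a)
    vanishes 0 _ = small 0 z≤n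
    vanishes 1 _ = small 1 z≤n
    vanishes 2 _ = small 2 (s≤s z≤n)
    vanishes 3 _ = small 3 (s≤s (s≤s (s≤s z≤n)))
    vanishes 4 _ = small 4 (s≤s (s≤s (s≤s (s≤s (s≤s z≤n)))))
    vanishes a@(suc (suc (suc (suc (suc n))))) IH j 2a≤j = begin
      fᶜ a j                                                  ≡⟨ fᶜ-unfold a k P (ℕP.m≤m+n 5 n) refl a≡ j ⟩
      shift (2 * k + 2) (fᶜ P) j ℤ.+ fᶜ k j ℤ.+ Sᶜ k P j      ≡⟨ cong₂ ℤ._+_ (cong₂ ℤ._+_ N≡0 F≡0) S≡0 ⟩
      + 0                                                     ∎
      where
      open ≡-Reasoning
      k = kstar a
      P = rest a
      a≡ = kstar-split a (s≤s z≤n)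
      k<a = proj₁ (split-< k P a≡)
      P<a = proj₂ (split-< k P a≡)
      regroup : ∀ k P → 2 * (suc k + P) ≡ 2 * k + 2 + 2 * P
      regroup = ℕ-Solver.solve-∀
      regroup′ : ∀ k P → k + (k + P) + (2 + P) ≡ 2 * (suc k + P)
      regroup′ = ℕ-Solver.solve-∀
      2a≡ : 2 * a ≡ 2 * k + 2 + 2 * P
      2a≡ = trans (cong (2 *_) a≡) (regroup k P)
      N≡0 : shift (2 * k + 2) (fᶜ P) j ≡ + 0
      N≡0 = shift-vanishesFrom (2 * k + 2) (IH P<a) j (subst (_≤ j) 2a≡ 2a≤j)
      F≡0 : fᶜ k j ≡ + 0
      F≡0 = IH k<a j (ℕP.≤-trans (ℕP.*-monoʳ-≤ 2 (ℕP.<⇒≤ k<a)) 2a≤j)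
      S≡0 : Sᶜ k P j ≡ + 0
      S≡0 = Sᶜ-vanishes k P j (ℕP.≤-trans (ℕP.m≤m+n (k + (k + P)) (2 + P))
                              (ℕP.≤-trans (ℕP.≤-reflexive (trans (regroup′ k P) (cong (2 *_) (sym a≡)))) 2a≤j))

  fᶜ-stable : ∀ a → AgreeFrom a (shift 2 (fᶜ a)) (fᶜ (suc a))
  fᶜ-stable 0 = agreeFrom-offset small
    where
    small : ∀ i → shift 2 (fᶜ 0) i ≡ fᶜ 1 i
    small 0 = refl
    small 1 = refl
    small (suc (suc i)) = refl
  fᶜ-stable 1 = agreeFrom-offset small
    where
    small : ∀ i → shift 2 (fᶜ 1) (1 + i) ≡ fᶜ 2 (1 + i)
    small 0 = refl
    small (suc i) = refl
  fᶜ-stable 2 = agreeFrom-offset small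
    where
    small : ∀ i → shift 2 (fᶜ 2) (2 + i) ≡ fᶜ 3 (2 + i)
    small 0 = refl
    small (suc i) = refl
  fᶜ-stable 3 = agreeFrom-offset small
    where
    small : ∀ i → shift 2 (fᶜ 3) (3 + i) ≡ fᶜ 4 (3 + i)
    small 0 = refl
    small 1 = refl
    small (suc (suc i)) = refl
  fᶜ-stable 4 = agreeFrom-offset small
    where
    small : ∀ i → shift 2 (fᶜ 4) (4 + i) ≡ fᶜ 5 (4 + i)
    small 0 = refl
    small 1 = refl
    small 2 = refl
    small (suc (suc (suc i))) = refl
  fᶜ-stable a@(suc (suc (suc (suc (suc n))))) = stable (kstar (suc a)) (rest (suc a)) refl (kstar-split (suc a) (s≤s z≤n))
    where
    5≤a : 5 ≤ a
    5≤a = ℕP.m≤m+n 5 n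
    -- With k = k*(a + 1): if k = 0 the remainder of a + 1 is a itself; otherwise
    -- k*(a) = k - 1 and f*(a) unfolds with the same remainder as f*(a + 1).
    stable : ∀ k P → kstar (suc a) ≡ k → suc a ≡ suc k + P → AgreeFrom a (shift 2 (fᶜ a)) (fᶜ (suc a))
    stable zero .a k*≡0 refl j a≤j = begin
      shift 2 (fᶜ a) j                                ≡⟨ trans (ℤP.+-identityʳ _) (ℤP.+-identityʳ _) ⟨
      shift 2 (fᶜ a) j ℤ.+ + 0 ℤ.+ + 0                ≡⟨ cong (ℤ._+_ (shift 2 (fᶜ a) j ℤ.+ + 0)) (Sᶜ-vanishes 0 a j a≤j) ⟨
      shift 2 (fᶜ a) j ℤ.+ + 0 ℤ.+ Sᶜ 0 a j           ≡⟨ fᶜ-unfold (suc a) 0 a (ℕP.m≤n⇒m≤1+n 5≤a) k*≡0 refl j ⟨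
      fᶜ (suc a) j                                    ∎
      where open ≡-Reasoning
    stable (suc k) P k*≡1+k 1+a≡ j a≤j = begin
      shift 2 (fᶜ a) j
        ≡⟨ shift-cong 2 (fᶜ-unfold a k P 5≤a (kstar-pred a k k*≡1+k) a≡) j ⟩
      shift 2 (shift (2 * k + 2) (fᶜ P) ⊞ fᶜ k ⊞ Sᶜ k P) j
        ≡⟨ trans (shift-⊞ 2 _ _ j) (cong (ℤ._+ shift 2 (Sᶜ k P) j) (shift-⊞ 2 _ _ j)) ⟩
      shift 2 (shift (2 * k + 2) (fᶜ P)) j ℤ.+ shift 2 (fᶜ k) j ℤ.+ shift 2 (Sᶜ k P) j
        ≡⟨ cong₂ ℤ._+_ (cong₂ ℤ._+_ N-stable F-stable) (sym (Sᶜ-stable k P j (subst (_≤ j) a≡ a≤j))) ⟩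
      shift (2 * suc k + 2) (fᶜ P) j ℤ.+ fᶜ (suc k) j ℤ.+ Sᶜ (suc k) P j
        ≡⟨ fᶜ-unfold (suc a) (suc k) P (ℕP.m≤n⇒m≤1+n 5≤a) k*≡1+k 1+a≡ j ⟨
      fᶜ (suc a) j
        ∎
      where
      open ≡-Reasoning
      a≡ : a ≡ suc k + P
      a≡ = ℕP.suc-injective 1+a≡
      2[1+k]≤a : 2 * suc k ≤ a
      2[1+k]≤a = ℕP.≤-pred (subst (λ x → 2 * x < suc a) k*≡1+k (kstar-double< (suc a) (s≤s z≤n)))
      N-stable : shift 2 (shift (2 * k + 2) (fᶜ P)) j ≡ shift (2 * suc k + 2) (fᶜ P) j
      N-stable = trans (shift-shift 2 (2 * k + 2) (fᶜ P) j) (cong (λ e → shift e (fᶜ P) j) (exponent k))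
        where
        exponent : ∀ k → 2 + (2 * k + 2) ≡ 2 * suc k + 2
        exponent = ℕ-Solver.solve-∀
      F-stable : shift 2 (fᶜ k) j ≡ fᶜ (suc k) j
      F-stable = trans (shift-vanishesFrom 2 (fᶜ-vanishes k) j (ℕP.≤-trans (ℕP.≤-reflexive (twice k)) (ℕP.≤-trans 2[1+k]≤a a≤j)))
                       (sym (fᶜ-vanishes (suc k) j (ℕP.≤-trans 2[1+k]≤a a≤j)))
        where
        twice : ∀ k → 2 + 2 * k ≡ 2 * suc k
        twice = ℕ-Solver.solve-∀

  fᶜ-stable-iter : ∀ t K → AgreeFrom (2 * t + K) (shift (2 * t + 2) (fᶜ K)) (fᶜ (suc t + K))
  fᶜ-stable-iter zero K = fᶜ-stable K
  fᶜ-stable-iter (suc t) K j bound = begin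
    shift (2 * suc t + 2) (fᶜ K) j         ≡⟨ cong (λ e → shift e (fᶜ K) j) (exponent t) ⟨
    shift (2 + (2 * t + 2)) (fᶜ K) j       ≡⟨ shift-shift 2 (2 * t + 2) (fᶜ K) j ⟨
    shift 2 (shift (2 * t + 2) (fᶜ K)) j   ≡⟨ shift-agreeFrom 2 (fᶜ-stable-iter t K) j (subst (_≤ j) (bound-eq t K) bound) ⟩
    shift 2 (fᶜ (suc t + K)) j             ≡⟨ fᶜ-stable (suc t + K) j (ℕP.≤-trans 1+t+K≤2[1+t]+K bound) ⟩
    fᶜ (suc (suc t + K)) j                 ∎
    where
    open ≡-Reasoning
    exponent : ∀ t → 2 + (2 * t + 2) ≡ 2 * suc t + 2
    exponent = ℕ-Solver.solve-∀
    1+t+K≤2[1+t]+K : suc t + K ≤ 2 * suc t + K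
    1+t+K≤2[1+t]+K = ℕP.+-monoˡ-≤ K (ℕP.m≤n*m (suc t) 2)
    bound-eq : ∀ t K → 2 * suc t + K ≡ 2 + (2 * t + K)
    bound-eq = ℕ-Solver.solve-∀

module Evaluation where

  open import Data.Nat using (zero; suc; z≤n; s≤s)
  open import Data.Integer as ℤ using (ℤ; +_; -[1+_])
  import Data.Integer.Properties as ℤP
  import Data.Nat.Coprimality as Coprimality
  open import Data.Rational as ℚ using (ℚ; mkℚ; _/_; 0ℚ; 1ℚ; _≤_)
  import Data.Rational.Properties as ℚP
  open import Data.Rational.Solver using (module +-*-Solver)
  open +-*-Solver using (solve; _:=_; _:+_; _:*_; :-_)
  open import Data.List using ([]; _∷_)
  open import Data.Product using (_,_)
  open import Data.Sum using (inj₁; inj₂)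
  open import Relation.Binary.PropositionalEquality

  integer : ℤ → ℚ
  integer a = mkℚ a 0 (Coprimality.sym (Coprimality.1-coprimeTo ℤ.∣ a ∣))

  /1-integer : ∀ a → a / 1 ≡ integer a
  /1-integer a = ℚP.↥p/↧p≡p (integer a)

  /1-+ : ∀ a b → (a ℤ.+ b) / 1 ≡ a / 1 ℚ.+ b / 1
  /1-+ a b = begin
    (a ℤ.+ b) / 1                               ≡⟨ cong₂ (λ x y → (x ℤ.+ y) / 1) (ℤP.*-identityʳ a) (ℤP.*-identityʳ b) ⟨
    (a ℤ.* + 1 ℤ.+ b ℤ.* + 1) / 1               ≡⟨⟩
    integer a ℚ.+ integer b                     ≡⟨ cong₂ ℚ._+_ (/1-integer a) (/1-integer b) ⟨
    a / 1 ℚ.+ b / 1                             ∎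
    where open ≡-Reasoning

  /1-neg : ∀ a → (ℤ.- a) / 1 ≡ ℚ.- (a / 1)
  /1-neg a = trans (/1-integer (ℤ.- a)) (trans (integer-neg a) (cong ℚ.-_ (sym (/1-integer a))))
    where
    integer-neg : ∀ a → integer (ℤ.- a) ≡ ℚ.- integer a
    integer-neg (+ zero) = refl
    integer-neg (+ suc n) = refl
    integer-neg -[1+ n ] = refl

  eval-⊕ : ∀ p q x → eval (p ⊕ q) x ≡ eval p x ℚ.+ eval q x
  eval-⊕ [] q x = sym (ℚP.+-identityˡ _)
  eval-⊕ (a ∷ p) [] x = sym (ℚP.+-identityʳ _)
  eval-⊕ (a ∷ p) (b ∷ q) x = trans (cong₂ (λ c v → c ℚ.+ x ℚ.* v) (/1-+ a b) (eval-⊕ p q x))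
    (regroup (a / 1) (b / 1) x (eval p x) (eval q x))
    where
    regroup : ∀ A B x P Q → (A ℚ.+ B) ℚ.+ x ℚ.* (P ℚ.+ Q) ≡ (A ℚ.+ x ℚ.* P) ℚ.+ (B ℚ.+ x ℚ.* Q)
    regroup = solve 5 (λ A B x P Q → (A :+ B) :+ x :* (P :+ Q) := (A :+ x :* P) :+ (B :+ x :* Q)) refl

  eval-neg : ∀ p x → eval (neg p) x ≡ ℚ.- eval p x
  eval-neg [] x = refl
  eval-neg (a ∷ p) x = trans (cong₂ (λ c v → c ℚ.+ x ℚ.* v) (/1-neg a) (eval-neg p x)) (regroup (a / 1) x (eval p x))
    where
    regroup : ∀ A x P → ℚ.- A ℚ.+ x ℚ.* (ℚ.- P) ≡ ℚ.- (A ℚ.+ x ℚ.* P)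
    regroup = solve 3 (λ A x P → :- A :+ x :* (:- P) := :- (A :+ x :* P)) refl

  eval-zero : ∀ p x → (∀ j → coeff p j ≡ + 0) → eval p x ≡ 0ℚ
  eval-zero [] x _ = refl
  eval-zero (a ∷ p) x p≡0 rewrite p≡0 0 | eval-zero p x (λ j → p≡0 (suc j)) =
    trans (cong (0ℚ ℚ.+_) (ℚP.*-zeroʳ x)) (ℚP.+-identityʳ 0ℚ)

  0≤p+∣p∣ : ∀ p → 0ℚ ≤ p ℚ.+ ℚ.∣ p ∣
  0≤p+∣p∣ p with ℚP.∣p∣≡p∨∣p∣≡-p p
  ... | inj₁ ∣p∣≡p =
    ℚP.≤-trans 0≤p (ℚP.≤-trans (ℚP.≤-reflexive (sym (ℚP.+-identityʳ p))) (ℚP.+-monoʳ-≤ p (ℚP.0≤∣p∣ p)))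
    where 0≤p = ℚP.∣p∣≡p⇒0≤p ∣p∣≡p
  ... | inj₂ ∣p∣≡-p = ℚP.≤-reflexive (sym (trans (cong (p ℚ.+_) ∣p∣≡-p) (ℚP.+-inverseʳ p)))

  coeffBound : Poly → ℚ
  coeffBound [] = 1ℚ
  coeffBound (a ∷ p) = ℚ.∣ a / 1 ∣ ℚ.+ coeffBound p

  coeffBound-tail : ∀ a p → coeffBound p ≤ coeffBound (a ∷ p)
  coeffBound-tail a p =
    ℚP.≤-trans (ℚP.≤-reflexive (sym (ℚP.+-identityˡ (coeffBound p)))) (ℚP.+-monoˡ-≤ (coeffBound p) (ℚP.0≤∣p∣ (a / 1)))

  1≤coeffBound : ∀ p → 1ℚ ≤ coeffBound p
  1≤coeffBound [] = ℚP.≤-refl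
  1≤coeffBound (a ∷ p) = ℚP.≤-trans (1≤coeffBound p) (coeffBound-tail a p)

  -- Induction on p: if x ≥ ∣a∣ + coeffBound p and p(x) ≥ 1, then a + x p(x) ≥ a + ∣a∣ + coeffBound p ≥ 1.
  1≤eval : ∀ p e → LeadingTerm p e → ∀ x → coeffBound p ≤ x → 1ℚ ≤ eval p x
  1≤eval [] e (() , _)
  1≤eval (a ∷ p) zero (a≡1 , above≡0) x _ rewrite a≡1 | eval-zero p x (λ j → above≡0 (suc j) (s≤s z≤n)) =
    ℚP.≤-reflexive (sym (trans (cong (1ℚ ℚ.+_) (ℚP.*-zeroʳ x)) (ℚP.+-identityʳ 1ℚ)))
  1≤eval (a ∷ p) (suc e) (lead , above≡0) x B≤x = begin
    1ℚ                                 ≤⟨ 1≤coeffBound p ⟩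
    coeffBound p                       ≡⟨ ℚP.+-identityˡ (coeffBound p) ⟨
    0ℚ ℚ.+ coeffBound p                ≤⟨ ℚP.+-monoˡ-≤ (coeffBound p) (0≤p+∣p∣ A) ⟩
    (A ℚ.+ ℚ.∣ A ∣) ℚ.+ coeffBound p   ≡⟨ ℚP.+-assoc A ℚ.∣ A ∣ (coeffBound p) ⟩
    A ℚ.+ (ℚ.∣ A ∣ ℚ.+ coeffBound p)   ≤⟨ ℚP.+-monoʳ-≤ A B≤x ⟩
    A ℚ.+ x                            ≡⟨ cong (A ℚ.+_) (ℚP.*-identityʳ x) ⟨
    A ℚ.+ x ℚ.* 1ℚ                     ≤⟨ ℚP.+-monoʳ-≤ A (ℚP.*-monoˡ-≤-nonNeg x {{ℚ.nonNegative 0≤x}} 1≤p[x]) ⟩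
    A ℚ.+ x ℚ.* eval p x               ∎
    where
    open ℚP.≤-Reasoning
    A = a / 1
    Bp≤x : coeffBound p ≤ x
    Bp≤x = ℚP.≤-trans (coeffBound-tail a p) B≤x
    1≤p[x] : 1ℚ ≤ eval p x
    1≤p[x] = 1≤eval p e (lead , λ j e<j → above≡0 (suc j) (s≤s e<j)) x Bp≤x
    0≤x : 0ℚ ≤ x
    0≤x = ℚP.≤-trans (ℚP.<⇒≤ (ℚP.positive⁻¹ 1ℚ)) (ℚP.≤-trans (1≤coeffBound p) Bp≤x)

  eventuallyGreater : ∀ p r e → LeadingTerm (p ⊕ neg r) e → EventuallyGreater p r
  eventuallyGreater p r e lead = coeffBound (p ⊕ neg r) , λ x B≤x → begin-strict
    eval r x                             ≡⟨ ℚP.+-identityʳ (eval r x) ⟨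
    eval r x ℚ.+ 0ℚ                      <⟨ ℚP.+-monoʳ-< (eval r x) (ℚP.<-≤-trans (ℚP.positive⁻¹ 1ℚ) (1≤difference x B≤x)) ⟩
    eval r x ℚ.+ (eval p x ℚ.- eval r x) ≡⟨ cancel (eval p x) (eval r x) ⟩
    eval p x                             ∎
    where
    open ℚP.≤-Reasoning
    cancel : ∀ P R → R ℚ.+ (P ℚ.- R) ≡ P
    cancel = solve 2 (λ P R → R :+ (P :+ :- R) := P) refl
    1≤difference : ∀ x → coeffBound (p ⊕ neg r) ≤ x → 1ℚ ≤ eval p x ℚ.- eval r x
    1≤difference x B≤x = subst (1ℚ ≤_) (trans (eval-⊕ p (neg r) x) (cong (eval p x ℚ.+_) (eval-neg r x)))
                                      (1≤eval (p ⊕ neg r) e lead x B≤x)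

module Spikes where

  open Sequences
  open Coefficients
  open Evaluation
  open FStarCoefficients
  open import Data.Nat using (ℕ; suc; _+_; _*_; _≤_; _<_; z≤n; s≤s)
  import Data.Nat.Properties as ℕP
  import Data.Nat.Tactic.RingSolver as ℕ-Solver
  open import Data.Integer as ℤ using (ℤ; +_; -[1+_]; ∣_∣)
  import Data.Integer.Properties as ℤP
  import Data.Integer.Tactic.RingSolver as ℤ-Solver
  open import Data.Product using (_×_; _,_)
  open import Relation.Binary.PropositionalEquality

  -- The contributions shared by all splittings d = k₁ + k₂; they cancel in the comparison.
  commonPart : ℕ → ℕ → Seq
  commonPart N D = shift (2 * D + 4) (fᶜ N) ⊞ fᶜ (suc D)

  commonKinks : ℕ → ℕ → Seq
  commonKinks N D = δ (2 * D + N + 3) ⊟ δ (2 * D + 3) ⊟ δ (D + N + 1)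

  SpikeAt : ℕ → ℕ → ℕ → Poly → Set
  SpikeAt N D a p = AgreeFrom a (ΔΔ (coeff p)) (δ a ⊞ (ΔΔ (commonPart N D) ⊞ commonKinks N D))

  spikeAt-intro : ∀ N D a p S → AgreeFrom a (ΔΔ (coeff p)) (ΔΔ (commonPart N D ⊞ S)) →
    AgreeFrom a (ΔΔ S) (δ a ⊞ commonKinks N D) → SpikeAt N D a p
  spikeAt-intro N D a p S ΔΔp≈ ΔΔS≈ j a≤j = begin
    ΔΔ (coeff p) j
      ≡⟨ ΔΔp≈ j a≤j ⟩
    ΔΔ (commonPart N D ⊞ S) j
      ≡⟨ ΔΔ-⊞ (commonPart N D) S j ⟩
    ΔΔ (commonPart N D) j ℤ.+ ΔΔ S j
      ≡⟨ cong (ℤ._+_ (ΔΔ (commonPart N D) j)) (ΔΔS≈ j a≤j) ⟩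
    ΔΔ (commonPart N D) j ℤ.+ (δ a j ℤ.+ commonKinks N D j)
      ≡⟨ swap (ΔΔ (commonPart N D) j) (δ a j) (commonKinks N D j) ⟩
    δ a j ℤ.+ (ΔΔ (commonPart N D) j ℤ.+ commonKinks N D j)
      ∎
    where
    open ≡-Reasoning
    swap : ∀ x y z → x ℤ.+ (y ℤ.+ z) ≡ y ℤ.+ (x ℤ.+ z)
    swap = ℤ-Solver.solve-∀

  ΔΔ-shift-Sᶜ : ∀ c K L →
    ΔΔ (shift c (Sᶜ K L)) ≗ (δ (c + K) ⊟ δ (c + (K + L))) ⊟ (δ (c + (suc K + K)) ⊟ δ (c + (suc K + (K + L))))
  ΔΔ-shift-Sᶜ c K L j = begin
    ΔΔ (shift c (Sᶜ K L)) j                             ≡⟨ ΔΔ-shift c (Sᶜ K L) j ⟩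
    shift c (ΔΔ (Sᶜ K L)) j                             ≡⟨ shift-cong c (ΔΔ-Sᶜ K L) j ⟩
    shift c ((δ K ⊟ δ (K + L)) ⊟ (δ (suc K + K) ⊟ δ (suc K + (K + L)))) j
      ≡⟨ trans (shift-⊟ c _ _ j) (cong₂ ℤ._-_ (shift-⊟ c _ _ j) (shift-⊟ c _ _ j)) ⟩
    (shift c (δ K) j ℤ.- shift c (δ (K + L)) j) ℤ.- (shift c (δ (suc K + K)) j ℤ.- shift c (δ (suc K + (K + L))) j)
      ≡⟨ cong₂ ℤ._-_ (cong₂ ℤ._-_ (shift-δ c _ j) (shift-δ c _ j)) (cong₂ ℤ._-_ (shift-δ c _ j) (shift-δ c _ j)) ⟩
    (δ (c + K) j ℤ.- δ (c + (K + L)) j) ℤ.- (δ (c + (suc K + K)) j ℤ.- δ (c + (suc K + (K + L))) j) ∎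
    where open ≡-Reasoning

  Spart : ℕ → ℕ → ℕ → Seq
  Spart N K₁ K₂ = shift (2 * K₁ + 2) (Sᶜ K₂ N) ⊞ Sᶜ K₁ (suc K₂ + N)

  ΔΔ-Spart : ∀ N K₁ K₂ → AgreeFrom (2 * K₁ + 2) (ΔΔ (Spart N K₁ K₂)) (δ (2 + (2 * K₁ + K₂)) ⊞ commonKinks N (K₁ + K₂))
  ΔΔ-Spart N K₁ K₂ j c≤j = begin
    ΔΔ (shift c (Sᶜ K₂ N) ⊞ Sᶜ K₁ L) j
      ≡⟨ ΔΔ-⊞ (shift c (Sᶜ K₂ N)) (Sᶜ K₁ L) j ⟩
    ΔΔ (shift c (Sᶜ K₂ N)) j ℤ.+ ΔΔ (Sᶜ K₁ L) j
      ≡⟨ cong₂ ℤ._+_ (ΔΔ-shift-Sᶜ c K₂ N j) (ΔΔ-Sᶜ K₁ L j) ⟩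
    ((δ (c + K₂) j ℤ.- δ (c + (K₂ + N)) j) ℤ.- (δ (c + (suc K₂ + K₂)) j ℤ.- δ (c + (suc K₂ + (K₂ + N))) j))
      ℤ.+ ((δ K₁ j ℤ.- δ (K₁ + L) j) ℤ.- (δ (suc K₁ + K₁) j ℤ.- δ (suc K₁ + (K₁ + L)) j))
      ≡⟨ cong₂ ℤ._+_ (cong₂ ℤ._-_ (cong₂ ℤ._-_ (at (apex K₁ K₂)) (at (cancelling K₁ K₂ N)))
                                  (cong₂ ℤ._-_ (at (kink₁ K₁ K₂)) (at (kink₂ K₁ K₂ N))))
                     (cong₂ ℤ._-_ (cong₂ ℤ._-_ (δ-above K₁<j) (at (kink₃ K₁ K₂ N))) (cong₂ ℤ._-_ (δ-above 2K₁+1<j) refl)) ⟩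
    ((δ (2 + (2 * K₁ + K₂)) j ℤ.- δ X j) ℤ.- (δ (2 * D + 3) j ℤ.- δ (2 * D + N + 3) j))
      ℤ.+ ((+ 0 ℤ.- δ (D + N + 1) j) ℤ.- (+ 0 ℤ.- δ X j))
      ≡⟨ collect (δ (2 + (2 * K₁ + K₂)) j) (δ X j) (δ (2 * D + 3) j) (δ (2 * D + N + 3) j) (δ (D + N + 1) j) ⟩
    δ (2 + (2 * K₁ + K₂)) j ℤ.+ commonKinks N D j
      ∎
    where
    open ≡-Reasoning
    c = 2 * K₁ + 2
    L = suc K₂ + N
    D = K₁ + K₂
    X = suc K₁ + (K₁ + L)
    at : ∀ {x y} → x ≡ y → δ x j ≡ δ y j
    at = cong (λ x → δ x j)
    K₁<j : K₁ < j
    K₁<j = ℕP.<-≤-trans (ℕP.≤-<-trans (ℕP.m≤n*m K₁ 2) (ℕP.m<m+n (2 * K₁) (s≤s z≤n))) c≤j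
    2K₁+1<j : suc K₁ + K₁ < j
    2K₁+1<j = ℕP.≤-trans (ℕP.≤-reflexive (index K₁)) c≤j
      where
      index : ∀ K₁ → suc (suc K₁ + K₁) ≡ 2 * K₁ + 2
      index = ℕ-Solver.solve-∀
    apex : ∀ K₁ K₂ → 2 * K₁ + 2 + K₂ ≡ 2 + (2 * K₁ + K₂)
    apex = ℕ-Solver.solve-∀
    cancelling : ∀ K₁ K₂ N → 2 * K₁ + 2 + (K₂ + N) ≡ suc K₁ + (K₁ + (suc K₂ + N))
    cancelling = ℕ-Solver.solve-∀
    kink₁ : ∀ K₁ K₂ → 2 * K₁ + 2 + (suc K₂ + K₂) ≡ 2 * (K₁ + K₂) + 3
    kink₁ = ℕ-Solver.solve-∀
    kink₂ : ∀ K₁ K₂ N → 2 * K₁ + 2 + (suc K₂ + (K₂ + N)) ≡ 2 * (K₁ + K₂) + N + 3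
    kink₂ = ℕ-Solver.solve-∀
    kink₃ : ∀ K₁ K₂ N → K₁ + (suc K₂ + N) ≡ K₁ + K₂ + N + 1
    kink₃ = ℕ-Solver.solve-∀
    collect : ∀ A X B C E → ((A ℤ.- X) ℤ.- (B ℤ.- C)) ℤ.+ ((+ 0 ℤ.- E) ℤ.- (+ 0 ℤ.- X)) ≡ A ℤ.+ ((C ℤ.- B) ℤ.- E)
    collect = ℤ-Solver.solve-∀

  ΔΔ-Spart-minus-one : ∀ N D → ΔΔ (Sᶜ (suc D) N) ≗ δ (suc D) ⊞ commonKinks N D
  ΔΔ-Spart-minus-one N D j = begin
    ΔΔ (Sᶜ (suc D) N) j
      ≡⟨ ΔΔ-Sᶜ (suc D) N j ⟩
    (δ (suc D) j ℤ.- δ (suc D + N) j) ℤ.- (δ (suc (suc D) + suc D) j ℤ.- δ (suc (suc D) + (suc D + N)) j)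
      ≡⟨ cong₂ ℤ._-_ (cong (ℤ._-_ (δ (suc D) j)) (at (kink₃ D N))) (cong₂ ℤ._-_ (at (kink₁ D)) (at (kink₂ D N))) ⟩
    (δ (suc D) j ℤ.- δ (D + N + 1) j) ℤ.- (δ (2 * D + 3) j ℤ.- δ (2 * D + N + 3) j)
      ≡⟨ collect (δ (suc D) j) (δ (2 * D + 3) j) (δ (2 * D + N + 3) j) (δ (D + N + 1) j) ⟩
    δ (suc D) j ℤ.+ commonKinks N D j
      ∎
    where
    open ≡-Reasoning
    at : ∀ {x y} → x ≡ y → δ x j ≡ δ y j
    at = cong (λ x → δ x j)
    kink₁ : ∀ D → suc (suc D) + suc D ≡ 2 * D + 3
    kink₁ = ℕ-Solver.solve-∀
    kink₂ : ∀ D N → suc (suc D) + (suc D + N) ≡ 2 * D + N + 3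
    kink₂ = ℕ-Solver.solve-∀
    kink₃ : ∀ D N → suc D + N ≡ D + N + 1
    kink₃ = ℕ-Solver.solve-∀
    collect : ∀ A B C E → (A ℤ.- E) ℤ.- (B ℤ.- C) ≡ A ℤ.+ ((C ℤ.- B) ℤ.- E)
    collect = ℤ-Solver.solve-∀

  u₂-top : ∀ N K₁ K₂ → AgreeFrom (2 * K₁ + K₂) (coeff (u₂ fstar (+ (N + (K₁ + K₂) + 2)) (+ K₁) (+ K₂)))
                                                (commonPart N (K₁ + K₂) ⊞ Spart N K₁ K₂)
  u₂-top N K₁ K₂ j e≤j = begin
    coeff (u₂ fstar (+ (N + (K₁ + K₂) + 2)) (+ K₁) (+ K₂)) j
      ≡⟨ coeff-u₂-fstar N K₁ K₂ j ⟩
    shift c (shift (2 * K₂ + 2) (fᶜ N) ⊞ fᶜ K₂ ⊞ Sᶜ K₂ N) j ℤ.+ fᶜ K₁ j ℤ.+ Sᶜ K₁ L j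
      ≡⟨ cong (λ x → x ℤ.+ fᶜ K₁ j ℤ.+ Sᶜ K₁ L j)
              (trans (shift-⊞ c _ _ j) (cong (ℤ._+ shift c (Sᶜ K₂ N) j) (shift-⊞ c _ _ j))) ⟩
    shift c (shift (2 * K₂ + 2) (fᶜ N)) j ℤ.+ shift c (fᶜ K₂) j ℤ.+ shift c (Sᶜ K₂ N) j ℤ.+ fᶜ K₁ j ℤ.+ Sᶜ K₁ L j
      ≡⟨ cong₂ (λ x y → x ℤ.+ shift c (Sᶜ K₂ N) j ℤ.+ y ℤ.+ Sᶜ K₁ L j)
           (cong₂ ℤ._+_ N-part (fᶜ-stable-iter K₁ K₂ j e≤j))
           (fᶜ-vanishes K₁ j (ℕP.≤-trans (ℕP.m≤m+n (2 * K₁) K₂) e≤j)) ⟩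
    shift (2 * D + 4) (fᶜ N) j ℤ.+ fᶜ (suc D) j ℤ.+ shift c (Sᶜ K₂ N) j ℤ.+ + 0 ℤ.+ Sᶜ K₁ L j
      ≡⟨ regroup (shift (2 * D + 4) (fᶜ N) j) (fᶜ (suc D) j) (shift c (Sᶜ K₂ N) j) (Sᶜ K₁ L j) ⟩
    commonPart N D j ℤ.+ Spart N K₁ K₂ j
      ∎
    where
    open ≡-Reasoning
    D = K₁ + K₂
    c = 2 * K₁ + 2
    L = suc K₂ + N
    N-part : shift c (shift (2 * K₂ + 2) (fᶜ N)) j ≡ shift (2 * D + 4) (fᶜ N) j
    N-part = trans (shift-shift c (2 * K₂ + 2) (fᶜ N) j) (cong (λ e → shift e (fᶜ N) j) (exponent K₁ K₂))
      where
      exponent : ∀ K₁ K₂ → 2 * K₁ + 2 + (2 * K₂ + 2) ≡ 2 * (K₁ + K₂) + 4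
      exponent = ℕ-Solver.solve-∀
    regroup : ∀ a b x y → a ℤ.+ b ℤ.+ x ℤ.+ + 0 ℤ.+ y ≡ a ℤ.+ b ℤ.+ (x ℤ.+ y)
    regroup = ℤ-Solver.solve-∀

  spike-u₂ : ∀ N D K₁ K₂ → K₁ + K₂ ≡ D →
    SpikeAt N D (2 + (2 * K₁ + K₂)) (u₂ fstar (+ (N + D + 2)) (+ K₁) (+ K₂))
  spike-u₂ N .(K₁ + K₂) K₁ K₂ refl =
    spikeAt-intro N (K₁ + K₂) (2 + (2 * K₁ + K₂)) (u₂ fstar (+ (N + (K₁ + K₂) + 2)) (+ K₁) (+ K₂)) (Spart N K₁ K₂)
      (ΔΔ-agreeFrom (u₂-top N K₁ K₂)) (agreeFrom-mono 2K₁+2≤apex (ΔΔ-Spart N K₁ K₂))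
    where
    2K₁+2≤apex : 2 * K₁ + 2 ≤ 2 + (2 * K₁ + K₂)
    2K₁+2≤apex = ℕP.≤-trans (ℕP.≤-reflexive (ℕP.+-comm (2 * K₁) 2)) (ℕP.+-monoʳ-≤ 2 (ℕP.m≤m+n (2 * K₁) K₂))

  spike-u₂-minus-one : ∀ N D → SpikeAt N D (suc D) (u₂ fstar (+ (N + D + 2)) -[1+ 0 ] (+ suc D))
  spike-u₂-minus-one N D = spikeAt-intro N D (suc D) (u₂ fstar (+ (N + D + 2)) -[1+ 0 ] (+ suc D)) (Sᶜ (suc D) N)
    (λ j _ → ΔΔ-cong (coeff-u₂-fstar-minus-one N D) j) (λ j _ → ΔΔ-Spart-minus-one N D j)

  leading-difference : ∀ N D e a U V → SpikeAt N D (2 + e) U → SpikeAt N D a V → a < 2 + e → LeadingTerm (U ⊕ neg V) e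
  leading-difference N D e a U V spike-U spike-V a<2+e =
    leadingOne-from-ΔΔ {e} {coeff (U ⊕ neg V)} (coeff-finite (U ⊕ neg V)) ΔΔ≈δ
    where
    bg = ΔΔ (commonPart N D) ⊞ commonKinks N D
    cancel : ∀ x y → x ℤ.+ y ℤ.- (+ 0 ℤ.+ y) ≡ x
    cancel = ℤ-Solver.solve-∀
    ΔΔ≈δ : AgreeFrom (2 + e) (ΔΔ (coeff (U ⊕ neg V))) (δ (2 + e))
    ΔΔ≈δ j 2+e≤j = begin
      ΔΔ (coeff (U ⊕ neg V)) j                          ≡⟨ ΔΔ-cong (coeff-⊕-neg U V) j ⟩
      ΔΔ (coeff U ⊟ coeff V) j                          ≡⟨ ΔΔ-⊟ (coeff U) (coeff V) j ⟩
      ΔΔ (coeff U) j ℤ.- ΔΔ (coeff V) j                 ≡⟨ cong₂ ℤ._-_ (spike-U j 2+e≤j) (spike-V j (ℕP.<⇒≤ a<j)) ⟩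
      δ (2 + e) j ℤ.+ bg j ℤ.- (δ a j ℤ.+ bg j)         ≡⟨ cong (λ x → δ (2 + e) j ℤ.+ bg j ℤ.- (x ℤ.+ bg j)) (δ-above a<j) ⟩
      δ (2 + e) j ℤ.+ bg j ℤ.- (+ 0 ℤ.+ bg j)           ≡⟨ cancel (δ (2 + e) j) (bg j) ⟩
      δ (2 + e) j                                       ∎
      where
      open ≡-Reasoning
      a<j = ℕP.<-≤-trans a<2+e 2+e≤j

  leading⇒comparison : ∀ U V K₁ K₂ → LeadingTerm (U ⊕ neg V) (2 * K₁ + K₂) →
    EventuallyGreater U V × LeadingTerm (U ⊕ neg V) ∣ + 2 ℤ.* + K₁ ℤ.+ + K₂ ∣
  leading⇒comparison U V K₁ K₂ lead = eventuallyGreater U V _ lead , subst (LeadingTerm (U ⊕ neg V)) (sym ∣2K₁+K₂∣) lead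
    where
    ∣2K₁+K₂∣ : ∣ + 2 ℤ.* + K₁ ℤ.+ + K₂ ∣ ≡ 2 * K₁ + K₂
    ∣2K₁+K₂∣ = cong (λ i → ∣ i ℤ.+ + K₂ ∣) (ℤP.+◃n≡+n (2 * K₁))

  compare-u₂ : ∀ N K₁ K₂ L₁ L₂ → L₁ + L₂ ≡ K₁ + K₂ → K₂ < L₂ →
    let m = + (N + (K₁ + K₂) + 2); U = u₂ fstar m (+ K₁) (+ K₂); V = u₂ fstar m (+ L₁) (+ L₂) in
    EventuallyGreater U V × LeadingTerm (U ⊕ neg V) ∣ + 2 ℤ.* + K₁ ℤ.+ + K₂ ∣
  compare-u₂ N K₁ K₂ L₁ L₂ L≡K K₂<L₂ = leading⇒comparison U V K₁ K₂
    (leading-difference N (K₁ + K₂) (2 * K₁ + K₂) (2 + (2 * L₁ + L₂)) U V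
      (spike-u₂ N (K₁ + K₂) K₁ K₂ refl) (spike-u₂ N (K₁ + K₂) L₁ L₂ L≡K) (s≤s (s≤s 2L₁+L₂<2K₁+K₂)))
    where
    m = + (N + (K₁ + K₂) + 2)
    U = u₂ fstar m (+ K₁) (+ K₂)
    V = u₂ fstar m (+ L₁) (+ L₂)
    L₁<K₁ : L₁ < K₁
    L₁<K₁ = ℕP.+-cancelʳ-< L₂ L₁ K₁ (subst (_< K₁ + L₂) (sym L≡K) (ℕP.+-monoʳ-< K₁ K₂<L₂))
    unfold : ∀ x y → 2 * x + y ≡ x + (x + y)
    unfold = ℕ-Solver.solve-∀
    2L₁+L₂<2K₁+K₂ : 2 * L₁ + L₂ < 2 * K₁ + K₂
    2L₁+L₂<2K₁+K₂ = begin-strict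
      2 * L₁ + L₂       ≡⟨ unfold L₁ L₂ ⟩
      L₁ + (L₁ + L₂)    ≡⟨ cong (_+_ L₁) L≡K ⟩
      L₁ + (K₁ + K₂)    <⟨ ℕP.+-monoˡ-< (K₁ + K₂) L₁<K₁ ⟩
      K₁ + (K₁ + K₂)    ≡⟨ unfold K₁ K₂ ⟨
      2 * K₁ + K₂       ∎
      where open ℕP.≤-Reasoning

  compare-u₂-minus-one : ∀ N K₁ K₂ →
    let m = + (N + (K₁ + K₂) + 2); U = u₂ fstar m (+ K₁) (+ K₂); V = u₂ fstar m -[1+ 0 ] (+ suc (K₁ + K₂)) in
    EventuallyGreater U V × LeadingTerm (U ⊕ neg V) ∣ + 2 ℤ.* + K₁ ℤ.+ + K₂ ∣
  compare-u₂-minus-one N K₁ K₂ = leading⇒comparison U V K₁ K₂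
    (leading-difference N (K₁ + K₂) (2 * K₁ + K₂) (suc (K₁ + K₂)) U V
      (spike-u₂ N (K₁ + K₂) K₁ K₂ refl) (spike-u₂-minus-one N (K₁ + K₂))
      (s≤s (s≤s (ℕP.+-monoˡ-≤ K₂ (ℕP.m≤n*m K₁ 2)))))
    where
    m = + (N + (K₁ + K₂) + 2)
    U = u₂ fstar m (+ K₁) (+ K₂)
    V = u₂ fstar m -[1+ 0 ] (+ suc (K₁ + K₂))

open Spikes using (compare-u₂; compare-u₂-minus-one)
open import Data.Integer using (ℤ; +_; -_; _+_; _*_; _≤_; _<_; ∣_∣; -[1+_]; +<+; -≤-)
import Data.Integer.Properties as ℤP
open import Data.Nat using (suc)
open import Data.Product using (_×_)
open import Relation.Binary.PropositionalEquality using (_≡_; refl)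

lemma3p41 : (n k₁ k₂ ℓ₁ ℓ₂ d : ℤ) →
  + 1 ≤ n → + 0 ≤ k₁ → + 0 ≤ k₂ → + 0 ≤ ℓ₂ → - + 1 ≤ ℓ₁ →
  k₁ + k₂ ≡ d → ℓ₁ + ℓ₂ ≡ d → k₂ < ℓ₂ →
  Valid (n + d + + 2) k₁ → Valid (n + k₂ + + 1) k₂ →
  Valid (n + d + + 2) ℓ₁ → Valid (n + ℓ₂ + + 1) ℓ₂ →
  EventuallyGreater (u₂ fstar (n + d + + 2) k₁ k₂) (u₂ fstar (n + d + + 2) ℓ₁ ℓ₂)
  × LeadingTerm (u₂ fstar (n + d + + 2) k₁ k₂ ⊕ neg (u₂ fstar (n + d + + 2) ℓ₁ ℓ₂)) ∣ + 2 * k₁ + k₂ ∣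
lemma3p41 -[1+ _ ] _ _ _ _ _ () _ _ _ _ _ _ _ _ _ _ _
lemma3p41 (+ _) -[1+ _ ] _ _ _ _ _ () _ _ _ _ _ _ _ _ _ _
lemma3p41 (+ _) (+ _) -[1+ _ ] _ _ _ _ _ () _ _ _ _ _ _ _ _ _
lemma3p41 (+ _) (+ _) (+ _) _ -[1+ _ ] _ _ _ _ () _ _ _ _ _ _ _ _
lemma3p41 (+ _) (+ _) (+ _) -[1+ suc _ ] (+ _) _ _ _ _ _ (-≤- ()) _ _ _ _ _ _ _
lemma3p41 (+ N) (+ K₁) (+ K₂) -[1+ 0 ] (+ suc L) _ _ _ _ _ _ refl ℓ₁+ℓ₂≡d _ _ _ _ _
  with refl ← ℤP.+-injective ℓ₁+ℓ₂≡d = compare-u₂-minus-one N K₁ K₂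
lemma3p41 (+ N) (+ K₁) (+ K₂) (+ L₁) (+ L₂) _ _ _ _ _ _ refl ℓ₁+ℓ₂≡d (+<+ K₂<L₂) _ _ _ _ =
  compare-u₂ N K₁ K₂ L₁ L₂ (ℤP.+-injective ℓ₁+ℓ₂≡d) K₂<L₂
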